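{- Let $q$ be a prime power, $n\ge2$, and let $\mathcal M=(\mathcal L(E),\rho_{\mathcal M})$ be a $q$-matroid of rank one on $E=\mathbb F_q^n$. Then there is no integer $m>1$ such that $\mathcal M$ is purely $m$-multilinear.
   Context: $\mathcal L(E)$ is the set of subspaces of $E$; $U^\perp$ is the orthogonal complement under the standard dot product. A $q$-matroid on $E$ is $(\mathcal L(E),\rho)$ with $\rho:\mathcal L(E)\to\mathbb Z$ satisfying $0\le\rho(A)\le\dim A$, $A\subseteq B\Rightarrow\rho(A)\le\rho(B)$, and $\rho(A\cap B)+\rho(A+B)\le\rho(A)+\rho(B)$; its rank is $\rho(E)$. For an $\mathbb F_q$-linear $\mathcal C\subseteq\mathbb F_q^{n\times m}$ of dimension $k'$, $\rho_{\mathcal C}(U)=(k'-\dim\mathcal C(U^\perp))/m$ with $\mathcal C(W)=\{M\in\mathcal C:\operatorname{colsp}(M)\subseteq W\}$; $\mathcal M$ is $\mathbb F_q^{n\times m}$-representable if its rank function is $\rho_{\mathcal C}$ for some such $\mathcal C$. For $x\in\mathbb F_{q^m}^n$, $\operatorname{supp}(x)$ is the column space of the $n\times m$ matrix over $\mathbb F_q$ expanding the coordinates of $x$ in a fixed $\mathbb F_q$-basis of $\mathbb F_{q^m}$; $\mathcal M$ is $\mathbb F_{q^m}$-representable if its rank function is $W\mapsto K-\dim_{\mathbb F_{q^m}}\{x\in\mathcal C:\operatorname{supp}(x)\subseteq W^\perp\}$ for some $\mathbb F_{q^m}$-linear $\mathcal C\subseteq\mathbb F_{q^m}^n$ of dimension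 $K$. For $m>1$, $\mathcal M$ is purely $m$-multilinear if it is $\mathbb F_q^{n\times m}$-representable but not $\mathbb F_{q^m}$-representable. -}

module Defs where

open import Level using (0ℓ)
open import Data.Bool using (Bool; true; false; _∧_; not; _∨_; if_then_else_; T)
open import Data.Nat as ℕ using (ℕ; zero; suc; _^_; _≡ᵇ_)
open import Data.Integer as ℤ using (ℤ; +_)
open import Data.Fin using (Fin)
open import Data.List as List using (List; []; _∷_; length; filterᵇ; upTo; concatMap)
open import Data.Bool.ListAction using (all; any)
open import Data.List.Membership.Propositional using (_∈_)
open import Data.List.Relation.Unary.Unique.Propositional using (Unique)
open import Data.Vec as Vec using (Vec; lookup; zipWith; replicate)
import Data.Vec.Properties as VecP
open import Data.Product using (Σ; ∃; _×_)
open import Relation.Nullary using (¬_; does)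
open import Relation.Binary.PropositionalEquality using (_≡_; _≢_)
open import Relation.Binary.Definitions using (DecidableEquality)
open import Algebra.Core using (Op₁; Op₂)
import Algebra.Structures as AS

-- Finite fields (q = number of elements; automatically a prime power)

record FiniteField : Set₁ where
  infixl 6 _+_
  infixl 7 _*_
  field
    Carrier   : Set
    _+_ _*_   : Op₂ Carrier
    -_        : Op₁ Carrier
    0# 1#     : Carrier
    isCommutativeRing : AS.IsCommutativeRing _≡_ _+_ _*_ -_ 0# 1#
    0≢1       : 0# ≢ 1#
    inverse   : ∀ x → x ≢ 0# → ∃ λ y → x * y ≡ 1#
    _≟_       : DecidableEquality Carrier
    elements  : List Carrier
    complete  : ∀ x → x ∈ elements
    unique    : Unique elements

  size : ℕ
  size = length elements

allVecsOf : {A : Set} → List A → (n : ℕ) → List (Vec A n)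
allVecsOf xs zero    = Vec.[] ∷ []
allVecsOf xs (suc n) = concatMap (λ x → List.map (x Vec.∷_) (allVecsOf xs n)) xs

record FinSpace (K : FiniteField) : Set₁ where
  private module K = FiniteField K
  field
    V    : Set
    0v   : V
    _+v_ : V → V → V
    _·_  : K.Carrier → V → V
    _≟v_ : DecidableEquality V
    vecs : List V          -- enumeration of all elements of V

VecSpace : (K : FiniteField) → ℕ → FinSpace K
VecSpace K n = record
  { V = Vec Carrier n ; 0v = replicate n 0# ; _+v_ = zipWith _+_
  ; _·_ = λ c → Vec.map (c *_) ; _≟v_ = VecP.≡-dec _≟_
  ; vecs = allVecsOf elements n }
  where open FiniteField K

-- K^{n×m}  (a matrix is the vector of its n rows, each of length m)
Mat : (K : FiniteField) → ℕ → ℕ → Set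
Mat K n m = Vec (Vec (FiniteField.Carrier K) m) n

MatSpace : (K : FiniteField) → ℕ → ℕ → FinSpace K
MatSpace K n m = record
  { V = Mat K n m ; 0v = replicate n (replicate m 0#)
  ; _+v_ = zipWith (zipWith _+_)
  ; _·_ = λ c → Vec.map (Vec.map (c *_)) ; _≟v_ = VecP.≡-dec (VecP.≡-dec _≟_)
  ; vecs = allVecsOf (allVecsOf elements m) n }
  where open FiniteField K

column : {A : Set} {n m : ℕ} → Vec (Vec A m) n → Fin m → Vec A n
column M j = Vec.map (λ row → lookup row j) M

module _ {K : FiniteField} (S : FinSpace K) where
  open FinSpace S

  Subset : Set
  Subset = V → Bool

  record IsSubspace (A : Subset) : Set where
    field
      zero-mem    : A 0v ≡ true
      add-closed  : ∀ x y → A x ≡ true → A y ≡ true → A (x +v y) ≡ true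
      scal-closed : ∀ c x → A x ≡ true → A (c · x) ≡ true

  _⊆_ : Subset → Subset → Set
  A ⊆ B = ∀ v → A v ≡ true → B v ≡ true

  _∩_ : Subset → Subset → Subset
  (A ∩ B) v = A v ∧ B v

  _⊕_ : Subset → Subset → Subset
  (A ⊕ B) v = any (λ a → A a ∧ any (λ b → B b ∧ does ((a +v b) ≟v v)) vecs) vecs

  card : Subset → ℕ
  card A = length (filterᵇ A vecs)

-- discrete logarithm: the least d ≤ N with q ^ d = N (0 if none)
logBase : ℕ → ℕ → ℕ
logBase q N = go (upTo (suc N))
  where
  go : List ℕ → ℕ
  go []       = 0
  go (d ∷ ds) = if (q ^ d) ≡ᵇ N then d else go ds

dim : {K : FiniteField} (S : FinSpace K) → Subset S → ℕ
dim {K} S A = logBase (FiniteField.size K) (card S A)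

module _ (F : FiniteField) (n : ℕ) where
  open FiniteField F

  E : FinSpace F
  E = VecSpace F n

  dot : Vec Carrier n → Vec Carrier n → Carrier
  dot u v = Vec.foldr _ _+_ 0# (zipWith _*_ u v)

  _⊥ : Subset E → Subset E
  (U ⊥) v = all (λ u → not (U u) ∨ does (dot u v ≟ 0#)) (FinSpace.vecs E)

  whole : Subset E
  whole _ = true

record QMatroid (F : FiniteField) (n : ℕ) : Set₁ where
  field
    ρ : Subset (E F n) → ℤ
    -- the axioms are required on L(E), the subspaces of E
    R1 : ∀ A → IsSubspace (E F n) A → + 0 ℤ.≤ ρ A × ρ A ℤ.≤ + dim (E F n) A
    R2 : ∀ A B → IsSubspace (E F n) A → IsSubspace (E F n) B →
         _⊆_ (E F n) A B → ρ A ℤ.≤ ρ B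
    R3 : ∀ A B → IsSubspace (E F n) A → IsSubspace (E F n) B →
         ρ (_∩_ (E F n) A B) ℤ.+ ρ (_⊕_ (E F n) A B) ℤ.≤ ρ A ℤ.+ ρ B

  rank : ℤ
  rank = ρ (whole F n)

module _ {F : FiniteField} {n : ℕ} where

  colsp⊆ : {m : ℕ} → Mat F n m → Subset (E F n) → Bool
  colsp⊆ {m} M W = all (λ j → W (column M j)) (List.allFin m)

  restrict : {m : ℕ} → Subset (MatSpace F n m) → Subset (E F n) → Subset (MatSpace F n m)
  restrict C W M = C M ∧ colsp⊆ M W

  -- ρ(U) = (k' - dim C(U^⊥)) / m,  written as  m · ρ(U) = k' - dim C(U^⊥)
  MatrixRepresentable : QMatroid F n → ℕ → Set
  MatrixRepresentable M m =
    Σ (Subset (MatSpace F n m)) λ C → IsSubspace (MatSpace F n m) C ×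
      (∀ U → IsSubspace (E F n) U →
         + m ℤ.* QMatroid.ρ M U ≡
           + dim (MatSpace F n m) C ℤ.- + dim (MatSpace F n m) (restrict C (_⊥ F n U)))

-- F_{q^m}: a field extension L of F together with a fixed F-basis,
-- given by the F-linear coordinate bijection  coord : L → F^m

record Extension (F : FiniteField) (m : ℕ) : Set₁ where
  private module F = FiniteField F
  field
    L : FiniteField
  private module L = FiniteField L
  field
    ι        : F.Carrier → L.Carrier
    ι-1      : ι F.1# ≡ L.1#
    ι-+      : ∀ a b → ι (a F.+ b) ≡ ι a L.+ ι b
    ι-*      : ∀ a b → ι (a F.* b) ≡ ι a L.* ι b
    coord    : L.Carrier → Vec F.Carrier m
    coord-inj  : ∀ x y → coord x ≡ coord y → x ≡ y
    coord-surj : ∀ v → ∃ λ x → coord x ≡ v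
    coord-+  : ∀ x y → coord (x L.+ y) ≡ zipWith F._+_ (coord x) (coord y)
    coord-·  : ∀ c x → coord (ι c L.* x) ≡ Vec.map (c F.*_) (coord x)

module _ {F : FiniteField} {n m : ℕ} (X : Extension F m) where
  open Extension X

  expand : Vec (FiniteField.Carrier L) n → Mat F n m
  expand x = Vec.map coord x

  supp⊆ : Vec (FiniteField.Carrier L) n → Subset (E F n) → Bool
  supp⊆ x W = colsp⊆ {F} {n} {m} (expand x) W

  ExtRepresentable : QMatroid F n → Set
  ExtRepresentable M =
    Σ (Subset (VecSpace L n)) λ C → IsSubspace (VecSpace L n) C ×
      (∀ W → IsSubspace (E F n) W →
         QMatroid.ρ M W ≡
           + dim (VecSpace L n) C
             ℤ.- + dim (VecSpace L n) (λ x → C x ∧ supp⊆ x (_⊥ F n W)))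

  -- purely m-multilinear (for m > 1, imposed in the theorem)
  PurelyMultilinear : QMatroid F n → Set
  PurelyMultilinear M = MatrixRepresentable M m × ¬ ExtRepresentable M

{-# OPTIONS --safe #-}
module Submission where

-- Let C ⊆ F^{n×m} represent M.  Since ρ(E) = 1 and C(E^⊥) = C(0) = 0, dim C = m; pick a nonzero
-- M₀ ∈ C and let x₀ ∈ F_{q^m}^n be the vector whose coordinates are the rows of M₀.  Every ρ(W)
-- is 0 or 1.  If ρ(W) = 0 then dim C(W^⊥) = dim C, so M₀ ∈ C(W^⊥), i.e. supp x₀ ⊆ W^⊥; then
-- supp(μ x₀) ⊆ W^⊥ for all μ, since the columns of the expansion of μ x₀ are F_q-linear
-- combinations of the columns of M₀.  If ρ(W) = 1 then C(W^⊥) = 0, so supp x₀ ⊈ W^⊥, hence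
-- supp(μ x₀) ⊈ W^⊥ for μ ≠ 0.  Thus ρ(W) = 1 - dim {y ∈ F_{q^m} x₀ : supp y ⊆ W^⊥}: the line
-- F_{q^m} x₀ represents M over F_{q^m}.
--
-- Dimensions are logarithms of cardinalities, so the counting rests on |A| = q^d for every
-- F_q-subspace A, proved by splitting A along a linear functional that does not vanish on it.

open import Defs
open import Level using (0ℓ)
open import Algebra.Bundles using (CommutativeRing; AbelianGroup)
import Algebra.Properties.CommutativeSemigroup as CommutativeSemigroupProperties
import Algebra.Properties.Group as GroupProperties
import Algebra.Properties.Ring as RingProperties
import Data.Bool as Bool
open import Data.Bool using (Bool; true; false; T; T?; _∧_; _∨_; not; if_then_else_)
open import Data.Bool.Properties using (T-≡)
open import Data.Bool.ListAction using (all; any)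
import Data.Fin as Fin
open Fin using (Fin)
open import Data.Integer as ℤ using (+_)
import Data.Integer.Properties as ℤ
open import Data.List as List
  using (List; []; _∷_; length; filter; filterᵇ; upTo; applyUpTo; cartesianProductWith; cartesianProduct)
open import Data.List.Properties using (length-filter; length-map; length-++)
open import Data.List.Membership.Propositional using (_∈_; find; lose)
open import Data.List.Membership.Propositional.Properties
  using ( ∈-filter⁺; ∈-filter⁻; ∈-map⁺; ∈-map⁻; ∈-cartesianProductWith⁺; ∈-cartesianProduct⁺
        ; ∈-cartesianProduct⁻; ∈-upTo⁺; ∈-allFin)
open import Data.List.Membership.Propositional.Properties.WithK using (unique∧set⇒bag)
open import Data.List.Relation.Binary.BagAndSetEquality using (∼bag⇒↭)
open import Data.List.Relation.Binary.Permutation.Propositional.Properties using (↭-length)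
open import Data.List.Relation.Unary.All as All using (All)
open import Data.List.Relation.Unary.All.Properties using (all⁺; all⁻)
open import Data.List.Relation.Unary.AllPairs using ([]; _∷_)
open import Data.List.Relation.Unary.Any as Any using (here; there; any?; satisfied)
open import Data.List.Relation.Unary.Any.Properties using (any⁺; any⁻)
open import Data.List.Relation.Unary.Unique.Propositional using (Unique)
import Data.List.Relation.Unary.Unique.Propositional.Properties as Unique
open import Data.Nat as ℕ using (ℕ; zero; suc; _^_; _≡ᵇ_; _≤_; _<_; s≤s; z≤n)
import Data.Nat.Properties as ℕ
open import Data.Nat.Induction using (<-wellFounded)
open import Data.Product using (∃; _×_; _,_; proj₁; proj₂; map₂)
open import Data.Sum using (_⊎_; inj₁; inj₂)
open import Data.Vec as Vec using (Vec)
import Data.Vec.Properties as Vec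
open import Function using (_∘_; _⇔_; mk⇔; Equivalence)
open import Induction.WellFounded using (Acc; acc)
open import Relation.Binary.Definitions using (DecidableEquality; tri<; tri≈; tri>)
open import Relation.Binary.PropositionalEquality
  using (_≡_; _≢_; refl; sym; trans; cong; cong₂; subst; module ≡-Reasoning)
open import Relation.Nullary using (¬_; Dec; does; contradiction; yes; no; ¬?; _×-dec_)
open import Relation.Nullary.Decidable using (dec-true; dec-false; decidable-stable)

private variable
  A : Set
  x : A
  xs ys : List A

≡true⇒T : ∀ {b} → b ≡ true → T b
≡true⇒T = Equivalence.from T-≡

T⇒≡true : ∀ {b} → T b → b ≡ true
T⇒≡true = Equivalence.to T-≡

∧-≡true⁺ : ∀ {a b} → a ≡ true → b ≡ true → a ∧ b ≡ true
∧-≡true⁺ refl refl = refl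

∧-≡true⁻ : ∀ {a b} → a ∧ b ≡ true → a ≡ true × b ≡ true
∧-≡true⁻ {true} {true} _ = refl , refl

∨-≡true⁺ : ∀ a {b} → (a ≡ true → b ≡ true) → not a ∨ b ≡ true
∨-≡true⁺ true  a⇒b = a⇒b refl
∨-≡true⁺ false _   = refl

∨-≡true⁻ : ∀ a {b} → not a ∨ b ≡ true → a ≡ true → b ≡ true
∨-≡true⁻ true b refl = b

does-≡true⁻ : ∀ {P : Set} (P? : Dec P) → does P? ≡ true → P
does-≡true⁻ (yes p) _ = p

∈-filterᵇ⁺ : (p : A → Bool) → x ∈ xs → p x ≡ true → x ∈ filterᵇ p xs
∈-filterᵇ⁺ p x∈xs px = ∈-filter⁺ (T? ∘ p) x∈xs (≡true⇒T px)

∈-filterᵇ⁻ : (p : A → Bool) (xs : List A) → x ∈ filterᵇ p xs → x ∈ xs × p x ≡ true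
∈-filterᵇ⁻ p xs x∈ = map₂ T⇒≡true (∈-filter⁻ (T? ∘ p) {xs = xs} x∈)

all-≡true⁺ : (p : A → Bool) (xs : List A) → (∀ {x} → x ∈ xs → p x ≡ true) → all p xs ≡ true
all-≡true⁺ p xs h = T⇒≡true (all⁻ p (All.tabulate (≡true⇒T ∘ h)))

all-≡true⁻ : (p : A → Bool) {xs : List A} → all p xs ≡ true → x ∈ xs → p x ≡ true
all-≡true⁻ p {xs} h x∈xs = T⇒≡true (All.lookup (all⁺ p xs (≡true⇒T h)) x∈xs)

any-≡true⁺ : (p : A → Bool) → x ∈ xs → p x ≡ true → any p xs ≡ true
any-≡true⁺ p x∈xs px = T⇒≡true (any⁺ p (Any.map (λ { refl → ≡true⇒T px }) x∈xs))

any-≡true⁻ : (p : A → Bool) (xs : List A) → any p xs ≡ true → ∃ λ x → x ∈ xs × p x ≡ true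
any-≡true⁻ p xs h = let (x , x∈xs , px) = find (any⁻ p xs (≡true⇒T h)) in x , x∈xs , T⇒≡true px

length-unique : Unique xs → Unique ys → (∀ {x} → x ∈ xs ⇔ x ∈ ys) → length xs ≡ length ys
length-unique uxs uys xs≈ys = ↭-length (∼bag⇒↭ (unique∧set⇒bag uxs uys xs≈ys))

length-unique-≤ : {xs ys : List A} → DecidableEquality A → Unique xs → Unique ys → (∀ {x} → x ∈ xs → x ∈ ys) →
                  length xs ≤ length ys
length-unique-≤ {xs = xs} {ys} _≟_ uxs uys xs⊆ys = begin
  length xs                    ≡⟨ length-unique uxs (Unique.filter⁺ (_∈? xs) uys) xs≈ys∩xs ⟩
  length (filter (_∈? xs) ys)  ≤⟨ length-filter (_∈? xs) ys ⟩
  length ys                    ∎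
  where
  open ℕ.≤-Reasoning
  open import Data.List.Membership.DecPropositional _≟_ using (_∈?_)
  xs≈ys∩xs : ∀ {z} → z ∈ xs ⇔ z ∈ filter (_∈? xs) ys
  xs≈ys∩xs = mk⇔ (λ x∈xs → ∈-filter⁺ (_∈? xs) (xs⊆ys x∈xs) x∈xs) (proj₂ ∘ ∈-filter⁻ (_∈? xs) {xs = ys})

allVecsOf-suc : (xs : List A) (n : ℕ) →
                allVecsOf xs (suc n) ≡ cartesianProductWith Vec._∷_ xs (allVecsOf xs n)
allVecsOf-suc xs n = concatMap≡cartesianProductWith xs
  where
  concatMap≡cartesianProductWith : ∀ zs → List.concatMap (λ z → List.map (z Vec.∷_) (allVecsOf xs n)) zs
                                          ≡ cartesianProductWith Vec._∷_ zs (allVecsOf xs n)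
  concatMap≡cartesianProductWith []       = refl
  concatMap≡cartesianProductWith (z ∷ zs) =
    cong (List.map (z Vec.∷_) (allVecsOf xs n) List.++_) (concatMap≡cartesianProductWith zs)

nonzero-entry : ∀ {k} {z : A} → DecidableEquality A → (v : Vec A k) → v ≢ Vec.replicate k z →
                ∃ λ i → Vec.lookup v i ≢ z
nonzero-entry _≟_ Vec.[]       v≢z = contradiction refl v≢z
nonzero-entry {z = z} _≟_ (a Vec.∷ v) a∷v≢z with a ≟ z
... | no  a≢z  = Fin.zero , a≢z
... | yes refl = let (i , vᵢ≢z) = nonzero-entry _≟_ v (a∷v≢z ∘ cong (z Vec.∷_)) in Fin.suc i , vᵢ≢z

length-cartesianProductWith : {B C : Set} (f : A → B → C) (xs : List A) (ys : List B) →
                              length (cartesianProductWith f xs ys) ≡ length xs ℕ.* length ys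
length-cartesianProductWith f []       ys = refl
length-cartesianProductWith f (x ∷ xs) ys = begin
  length (List.map (f x) ys List.++ cartesianProductWith f xs ys)
    ≡⟨ length-++ (List.map (f x) ys) ⟩
  length (List.map (f x) ys) ℕ.+ length (cartesianProductWith f xs ys)
    ≡⟨ cong₂ ℕ._+_ (length-map (f x) ys) (length-cartesianProductWith f xs ys) ⟩
  length ys ℕ.+ length xs ℕ.* length ys
    ∎
  where open ≡-Reasoning

∈-allVecsOf : (∀ x → x ∈ xs) → ∀ n (v : Vec A n) → v ∈ allVecsOf xs n
∈-allVecsOf ∈xs zero    Vec.[]       = here refl
∈-allVecsOf {xs = xs} ∈xs (suc n) (x Vec.∷ v) rewrite allVecsOf-suc xs n =
  ∈-cartesianProductWith⁺ Vec._∷_ (∈xs x) (∈-allVecsOf ∈xs n v)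

allVecsOf-unique : Unique xs → ∀ n → Unique (allVecsOf xs n)
allVecsOf-unique uxs zero    = All.[] ∷ []
allVecsOf-unique {xs = xs} uxs (suc n) rewrite allVecsOf-suc xs n =
  Unique.cartesianProductWith⁺ Vec._∷_ Vec.∷-injective uxs (allVecsOf-unique uxs n)

-- Discrete logarithms

firstPower : ℕ → ℕ → List ℕ → ℕ
firstPower q N []       = 0
firstPower q N (d ∷ ds) = if q ^ d ≡ᵇ N then d else firstPower q N ds

private
  clauses⇒firstPower : ∀ q N (g : List ℕ → ℕ) → g [] ≡ 0 →
                       (∀ d ds → g (d ∷ ds) ≡ (if q ^ d ≡ᵇ N then d else g ds)) →
                       ∀ ds → g ds ≡ firstPower q N ds
  clauses⇒firstPower q N g g[] g∷ []       = g[]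
  clauses⇒firstPower q N g g[] g∷ (d ∷ ds) =
    trans (g∷ d ds) (cong (if q ^ d ≡ᵇ N then d else_) (clauses⇒firstPower q N g g[] g∷ ds))

-- `logBase` scans `upTo (suc N)` with a local function that cannot be named; it obeys the
-- clauses of `firstPower`, and unification against the abstracted list identifies it.
logBase≡firstPower : ∀ q N → logBase q N ≡ firstPower q N (upTo (suc N))
logBase≡firstPower q N with clauses⇒firstPower q N _ refl (λ _ _ → refl) | applyUpTo suc N
... | go≡firstPower | ds = cong (if 1 ≡ᵇ N then 0 else_) (go≡firstPower ds)

module _ {q : ℕ} (1<q : 1 < q) where

  n<q^n : ∀ n → n < q ^ n
  n<q^n zero    = s≤s z≤n
  n<q^n (suc n) = ℕ.≤-<-trans (n<q^n n) (ℕ.^-monoʳ-< q 1<q (ℕ.n<1+n n))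

  ^-injectiveʳ : ∀ {d e} → q ^ d ≡ q ^ e → d ≡ e
  ^-injectiveʳ {d} {e} q^d≡q^e with ℕ.<-cmp d e
  ... | tri< d<e _ _ = contradiction q^d≡q^e (ℕ.<⇒≢ (ℕ.^-monoʳ-< q 1<q d<e))
  ... | tri≈ _ d≡e _ = d≡e
  ... | tri> _ _ e<d = contradiction (sym q^d≡q^e) (ℕ.<⇒≢ (ℕ.^-monoʳ-< q 1<q e<d))

  firstPower-^ : ∀ {d ds} → d ∈ ds → firstPower q (q ^ d) ds ≡ d
  firstPower-^ {d} {e ∷ ds} d∈e∷ds
    with q ^ e ≡ᵇ q ^ d | ℕ.≡ᵇ⇒≡ (q ^ e) (q ^ d) | ℕ.≡⇒≡ᵇ (q ^ e) (q ^ d) | d∈e∷ds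
  ... | true  | sound | _        | _          = ^-injectiveʳ (sound _)
  ... | false | _     | complete | here refl  = contradiction refl complete
  ... | false | _     | _        | there d∈ds = firstPower-^ d∈ds

  logBase-^ : ∀ d → logBase q (q ^ d) ≡ d
  logBase-^ d = trans (logBase≡firstPower q (q ^ d)) (firstPower-^ (∈-upTo⁺ (s≤s (ℕ.<⇒≤ (n<q^n d)))))

-- Finite vector spaces and the cardinality of their subspaces

module FieldProperties (K : FiniteField) where

  open FiniteField K public

  commutativeRing : CommutativeRing 0ℓ 0ℓ
  commutativeRing = record { isCommutativeRing = isCommutativeRing }

  open CommutativeRing commutativeRing public
    using (+-assoc; +-identityˡ; +-identityʳ; -‿inverseʳ;
           *-assoc; *-comm; *-identityˡ; *-identityʳ; distribˡ; distribʳ; zeroˡ; zeroʳ)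
  open RingProperties (CommutativeRing.ring commutativeRing) public
    using (-‿distribˡ-*; -‿involutive)
  open GroupProperties (CommutativeRing.+-group commutativeRing) public
    using (identityˡ-unique)
  open CommutativeSemigroupProperties (CommutativeRing.+-commutativeSemigroup commutativeRing) public
    using () renaming (interchange to +-interchange)
  open CommutativeSemigroupProperties (CommutativeRing.*-commutativeSemigroup commutativeRing) public
    using () renaming (x∙yz≈y∙xz to *-leftCommute)

  1<size : 1 < size
  1<size = length-unique-≤ _≟_ ((0≢1 All.∷ All.[]) ∷ All.[] ∷ []) unique (λ _ → complete _)

  map-0* : ∀ {k} (v : Vec Carrier k) → Vec.map (0# *_) v ≡ Vec.replicate k 0#
  map-0* v = trans (Vec.map-cong zeroˡ v) (Vec.map-const v 0#)

  map-*-map-* : ∀ {k} a b (v : Vec Carrier k) → Vec.map (a *_) (Vec.map (b *_) v) ≡ Vec.map ((a * b) *_) v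
  map-*-map-* a b v = trans (sym (Vec.map-∘ (a *_) (b *_) v)) (Vec.map-cong (λ c → sym (*-assoc a b c)) v)

  map-*-+ : ∀ {k} a b (v : Vec Carrier k) →
            Vec.zipWith _+_ (Vec.map (a *_) v) (Vec.map (b *_) v) ≡ Vec.map ((a + b) *_) v
  map-*-+ a b Vec.[]       = refl
  map-*-+ a b (c Vec.∷ v) = cong₂ Vec._∷_ (sym (distribʳ c a b)) (map-*-+ a b v)

  map-1* : ∀ {k} (v : Vec Carrier k) → Vec.map (1# *_) v ≡ v
  map-1* v = trans (Vec.map-cong *-identityˡ v) (Vec.map-id v)

  *-cancelʳ-≢0 : ∀ {a b c} → a ≢ 0# → b * a ≡ c * a → b ≡ c
  *-cancelʳ-≢0 {a} {b} {c} a≢0 ba≡ca = begin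
    b              ≡⟨ *-identityʳ b ⟨
    b * 1#         ≡⟨ cong (b *_) a*a⁻¹≡1 ⟨
    b * (a * a⁻¹)  ≡⟨ *-assoc b a a⁻¹ ⟨
    b * a * a⁻¹    ≡⟨ cong (_* a⁻¹) ba≡ca ⟩
    c * a * a⁻¹    ≡⟨ *-assoc c a a⁻¹ ⟩
    c * (a * a⁻¹)  ≡⟨ cong (c *_) a*a⁻¹≡1 ⟩
    c * 1#         ≡⟨ *-identityʳ c ⟩
    c              ∎
    where
    open ≡-Reasoning
    a⁻¹ = proj₁ (inverse a a≢0)
    a*a⁻¹≡1 = proj₂ (inverse a a≢0)

module _ {K : FiniteField} where
  open FiniteField K

  record IsLinearFunctional (S : FinSpace K) (φ : FinSpace.V S → Carrier) : Set where
    open FinSpace S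
    field
      +-hom : ∀ u v → φ (u +v v) ≡ φ u + φ v
      ·-hom : ∀ c v → φ (c · v) ≡ c * φ v

  -- Exactly what is needed to show that every subspace has q^d elements.
  record IsFinVectorSpace (S : FinSpace K) : Set where
    open FinSpace S
    field
      ∈-vecs       : ∀ v → v ∈ vecs
      vecs-unique  : Unique vecs
      +v-assoc     : ∀ u v w → (u +v v) +v w ≡ u +v (v +v w)
      +v-identityʳ : ∀ v → v +v 0v ≡ v
      ·-inverseʳ   : ∀ c v → (c · v) +v ((- c) · v) ≡ 0v
      separating   : ∀ v → v ≢ 0v → ∃ λ φ → IsLinearFunctional S φ × φ v ≢ 0#

Scalars : (K : FiniteField) → FinSpace K
Scalars K = record { V = Carrier ; 0v = 0# ; _+v_ = _+_ ; _·_ = _*_ ; _≟v_ = _≟_ ; vecs = elements }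
  where open FiniteField K

Power : {K : FiniteField} → FinSpace K → ℕ → FinSpace K
Power S n = record
  { V = Vec V n ; 0v = Vec.replicate n 0v ; _+v_ = Vec.zipWith _+v_
  ; _·_ = λ c → Vec.map (c ·_) ; _≟v_ = Vec.≡-dec _≟v_ ; vecs = allVecsOf vecs n }
  where open FinSpace S

module _ {K : FiniteField} where
  open FieldProperties K

  scalars-isFinVectorSpace : IsFinVectorSpace (Scalars K)
  scalars-isFinVectorSpace = record
    { ∈-vecs = complete ; vecs-unique = unique ; +v-assoc = +-assoc ; +v-identityʳ = +-identityʳ
    ; ·-inverseʳ = λ c v → trans (sym (distribʳ v c (- c))) (trans (cong (_* v) (-‿inverseʳ c)) (zeroˡ v))
    ; separating = λ v v≢0 → (λ x → x) , record { +-hom = λ _ _ → refl ; ·-hom = λ _ _ → refl } , v≢0 }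

  power-isFinVectorSpace : {S : FinSpace K} → IsFinVectorSpace S → ∀ n → IsFinVectorSpace (Power S n)
  power-isFinVectorSpace {S} isS n = record
    { ∈-vecs = ∈-allVecsOf ∈-vecs n
    ; vecs-unique = allVecsOf-unique vecs-unique n
    ; +v-assoc = Vec.zipWith-assoc +v-assoc
    ; +v-identityʳ = Vec.zipWith-identityʳ +v-identityʳ
    ; ·-inverseʳ = ·-inverseʳ′
    ; separating = separating′ }
    where
    open FinSpace S
    open IsFinVectorSpace isS
    ·-inverseʳ′ : ∀ {k} c (v : Vec V k) →
                  Vec.zipWith _+v_ (Vec.map (c ·_) v) (Vec.map ((- c) ·_) v) ≡ Vec.replicate k 0v
    ·-inverseʳ′ c Vec.[]       = refl
    ·-inverseʳ′ c (x Vec.∷ v) = cong₂ Vec._∷_ (·-inverseʳ c x) (·-inverseʳ′ c v)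
    separating′ : ∀ v → v ≢ Vec.replicate n 0v →
                  ∃ λ φ → IsLinearFunctional (Power S n) φ × φ v ≢ 0#
    separating′ v v≢0 with nonzero-entry _≟v_ v v≢0
    ... | i , vᵢ≢0 with separating (Vec.lookup v i) vᵢ≢0
    ... | φ , φ-lin , φvᵢ≢0 = (λ w → φ (Vec.lookup w i)) , lin , φvᵢ≢0
      where
      open IsLinearFunctional φ-lin
      lin : IsLinearFunctional (Power S n) (λ w → φ (Vec.lookup w i))
      lin = record
        { +-hom = λ u w → trans (cong φ (Vec.lookup-zipWith _+v_ i u w)) (+-hom _ _)
        ; ·-hom = λ c w → trans (cong φ (Vec.lookup-map i (c ·_) w)) (·-hom _ _) }

  vecSpace-isFinVectorSpace : ∀ n → IsFinVectorSpace (VecSpace K n)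
  vecSpace-isFinVectorSpace = power-isFinVectorSpace scalars-isFinVectorSpace

  matSpace-isFinVectorSpace : ∀ n m → IsFinVectorSpace (MatSpace K n m)
  matSpace-isFinVectorSpace n m = power-isFinVectorSpace (vecSpace-isFinVectorSpace m) n

module SubspaceCounting {K : FiniteField} {S : FinSpace K} (isS : IsFinVectorSpace S) where
  open FieldProperties K
  open FinSpace S
  open IsFinVectorSpace isS

  shift-unshift : ∀ c u w → (u +v (c · w)) +v ((- c) · w) ≡ u
  shift-unshift c u w = trans (+v-assoc u _ _) (trans (cong (u +v_) (·-inverseʳ c w)) (+v-identityʳ u))

  unshift-shift : ∀ c u w → (u +v ((- c) · w)) +v (c · w) ≡ u
  unshift-shift c u w = trans (cong (λ d → (u +v ((- c) · w)) +v (d · w)) (sym (-‿involutive c)))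
                              (shift-unshift (- c) u w)

  linear-0v : ∀ {φ} → IsLinearFunctional S φ → φ 0v ≡ 0#
  linear-0v {φ} φ-lin = identityˡ-unique (φ 0v) (φ 0v) (trans (sym (+-hom 0v 0v)) (cong φ (+v-identityʳ 0v)))
    where open IsLinearFunctional φ-lin

  filterᵇ-unique : (A : Subset S) → Unique (filterᵇ A vecs)
  filterᵇ-unique A = Unique.filter⁺ (T? ∘ A) vecs-unique

  card-≡-length : (A : Subset S) {xs : List V} → Unique xs → (∀ {v} → A v ≡ true ⇔ v ∈ xs) →
                  card S A ≡ length xs
  card-≡-length A uxs A⇔xs = length-unique (filterᵇ-unique A) uxs (mk⇔
    (λ v∈A → Equivalence.to A⇔xs (proj₂ (∈-filterᵇ⁻ A vecs v∈A)))
    (λ v∈xs → ∈-filterᵇ⁺ A (∈-vecs _) (Equivalence.from A⇔xs v∈xs)))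

  card-trivial : (A : Subset S) → A 0v ≡ true → (∀ v → A v ≡ true → v ≡ 0v) → card S A ≡ 1
  card-trivial A A0 trivial = card-≡-length A (All.[] ∷ [])
    (mk⇔ (λ Av → here (trivial _ Av)) λ { (here refl) → A0 })

  card-< : (A B : Subset S) → _⊆_ S A B → ∀ {v} → B v ≡ true → A v ≡ false → card S A < card S B
  card-< A B A⊆B {v} Bv Av =
    length-unique-≤ _≟v_ (All.tabulate v≢A ∷ filterᵇ-unique A) (filterᵇ-unique B) v∷A⊆B
    where
    v≢A : ∀ {w} → w ∈ filterᵇ A vecs → v ≢ w
    v≢A w∈A refl = contradiction (trans (sym (proj₂ (∈-filterᵇ⁻ A vecs w∈A))) Av) λ ()
    v∷A⊆B : ∀ {w} → w ∈ v ∷ filterᵇ A vecs → w ∈ filterᵇ B vecs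
    v∷A⊆B (here refl) = ∈-filterᵇ⁺ B (∈-vecs v) Bv
    v∷A⊆B (there w∈A) = let (w∈vecs , Aw) = ∈-filterᵇ⁻ A vecs w∈A in ∈-filterᵇ⁺ B w∈vecs (A⊆B _ Aw)

  trivial-or-nonzero : (A : Subset S) → (∀ v → A v ≡ true → v ≡ 0v) ⊎ (∃ λ v → A v ≡ true × v ≢ 0v)
  trivial-or-nonzero A with any? (λ v → (A v Bool.≟ true) ×-dec ¬? (v ≟v 0v)) vecs
  ... | yes nonzero  = inj₂ (satisfied nonzero)
  ... | no  ¬nonzero = inj₁ λ v Av →
    decidable-stable (v ≟v 0v) λ v≢0 → ¬nonzero (lose (∈-vecs v) (Av , v≢0))

  module KernelSplit (A : Subset S) (sA : IsSubspace S A) {s : V} (As : A s ≡ true)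
                     {φ : V → Carrier} (φ-lin : IsLinearFunctional S φ) (φs≢0 : φ s ≢ 0#) where
    open IsSubspace sA
    open IsLinearFunctional φ-lin

    A∩ker : Subset S
    A∩ker v = A v ∧ does (φ v ≟ 0#)

    A∩ker-isSubspace : IsSubspace S A∩ker
    A∩ker-isSubspace = record
      { zero-mem    = ∧-≡true⁺ zero-mem (dec-true (_ ≟ _) (linear-0v φ-lin))
      ; add-closed  = λ u v u∈ v∈ →
          let (Au , φu≡0) = ∧-≡true⁻ u∈ ; (Av , φv≡0) = ∧-≡true⁻ v∈ in
          ∧-≡true⁺ (add-closed u v Au Av) (dec-true (_ ≟ _) (begin
            φ (u +v v)   ≡⟨ +-hom u v ⟩
            φ u + φ v    ≡⟨ cong₂ _+_ (does-≡true⁻ (_ ≟ _) φu≡0) (does-≡true⁻ (_ ≟ _) φv≡0) ⟩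
            0# + 0#      ≡⟨ +-identityʳ 0# ⟩
            0#           ∎))
      ; scal-closed = λ c v v∈ →
          let (Av , φv≡0) = ∧-≡true⁻ v∈ in
          ∧-≡true⁺ (scal-closed c v Av) (dec-true (_ ≟ _) (begin
            φ (c · v)  ≡⟨ ·-hom c v ⟩
            c * φ v    ≡⟨ cong (c *_) (does-≡true⁻ (_ ≟ _) φv≡0) ⟩
            c * 0#     ≡⟨ zeroʳ c ⟩
            0#         ∎)) }
      where open ≡-Reasoning

    card-A∩ker-< : card S A∩ker < card S A
    card-A∩ker-< = card-< A∩ker A (λ _ → proj₁ ∘ ∧-≡true⁻) As s∉A∩ker
      where
      s∉A∩ker : A∩ker s ≡ false
      s∉A∩ker rewrite As = dec-false (φ s ≟ 0#) φs≢0

    private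
      φs⁻¹ = proj₁ (inverse (φ s) φs≢0)

      φs⁻¹*φs≡1 : φs⁻¹ * φ s ≡ 1#
      φs⁻¹*φs≡1 = trans (*-comm φs⁻¹ (φ s)) (proj₂ (inverse (φ s) φs≢0))

    coefficient : Carrier → Carrier
    coefficient c = c * φs⁻¹

    coefficient-φs : ∀ c → coefficient c * φ s ≡ c
    coefficient-φs c = trans (*-assoc c φs⁻¹ (φ s)) (trans (cong (c *_) φs⁻¹*φs≡1) (*-identityʳ c))

    project : V → V
    project u = u +v ((- coefficient (φ u)) · s)

    φ-project : ∀ u → φ (project u) ≡ 0#
    φ-project u = begin
      φ (u +v ((- coefficient (φ u)) · s))    ≡⟨ +-hom u _ ⟩
      φ u + φ ((- coefficient (φ u)) · s)     ≡⟨ cong (λ z → φ u + z) (·-hom _ s) ⟩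
      φ u + - coefficient (φ u) * φ s         ≡⟨ cong (λ z → φ u + z) (-‿distribˡ-* _ (φ s)) ⟨
      φ u + - (coefficient (φ u) * φ s)       ≡⟨ cong (λ c → φ u + - c) (coefficient-φs (φ u)) ⟩
      φ u + - φ u                             ≡⟨ -‿inverseʳ (φ u) ⟩
      0#                                      ∎
      where open ≡-Reasoning

    -- A bijection from A onto K × (A ∩ ker φ), with inverse (c , v) ↦ v + (c / φ s) s.
    decompose : V → Carrier × V
    decompose u = φ u , project u

    decompose-injective : ∀ {u w} → decompose u ≡ decompose w → u ≡ w
    decompose-injective {u} {w} eq = begin
      u                                         ≡⟨ unshift-shift (coefficient (φ u)) u s ⟨
      project u +v (coefficient (φ u) · s)      ≡⟨ cong₂ (λ p c → p +v (coefficient c · s))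
                                                          (cong proj₂ eq) (cong proj₁ eq) ⟩
      project w +v (coefficient (φ w) · s)      ≡⟨ unshift-shift (coefficient (φ w)) w s ⟩
      w                                         ∎
      where open ≡-Reasoning

    decompose-shift : ∀ c {v} → φ v ≡ 0# → decompose (v +v (coefficient c · s)) ≡ (c , v)
    decompose-shift c {v} φv≡0 = cong₂ _,_ φu≡c (begin
      project u                                  ≡⟨ cong (λ d → u +v ((- coefficient d) · s)) φu≡c ⟩
      u +v ((- coefficient c) · s)               ≡⟨ shift-unshift (coefficient c) v s ⟩
      v                                          ∎)
      where
      open ≡-Reasoning
      u = v +v (coefficient c · s)
      φu≡c : φ u ≡ c
      φu≡c = begin
        φ u                          ≡⟨ +-hom v _ ⟩
        φ v + φ (coefficient c · s)  ≡⟨ cong₂ _+_ φv≡0 (·-hom _ s) ⟩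
        0# + coefficient c * φ s     ≡⟨ +-identityˡ _ ⟩
        coefficient c * φ s          ≡⟨ coefficient-φs c ⟩
        c                            ∎

    decompose-image : ∀ {p} → p ∈ List.map decompose (filterᵇ A vecs) ⇔
                              p ∈ cartesianProduct elements (filterᵇ A∩ker vecs)
    decompose-image = mk⇔ into onto
      where
      into : ∀ {p} → p ∈ List.map decompose (filterᵇ A vecs) →
                     p ∈ cartesianProduct elements (filterᵇ A∩ker vecs)
      into p∈ with ∈-map⁻ decompose p∈
      ... | u , u∈A , refl = ∈-cartesianProduct⁺ (complete (φ u)) (∈-filterᵇ⁺ A∩ker (∈-vecs _)
              (∧-≡true⁺ (add-closed _ _ Au (scal-closed _ s As)) (dec-true (_ ≟ _) (φ-project u))))
        where Au = proj₂ (∈-filterᵇ⁻ A vecs u∈A)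
      onto : ∀ {p} → p ∈ cartesianProduct elements (filterᵇ A∩ker vecs) →
                     p ∈ List.map decompose (filterᵇ A vecs)
      onto {c , v} p∈ =
        let (_ , v∈A∩ker) = ∈-filterᵇ⁻ A∩ker vecs (proj₂ (∈-cartesianProduct⁻ elements _ p∈))
            (Av , φv≡0)  = ∧-≡true⁻ v∈A∩ker
            u∈A = ∈-filterᵇ⁺ A (∈-vecs _) (add-closed v _ Av (scal-closed (coefficient c) s As))
        in subst (_∈ List.map decompose (filterᵇ A vecs)) (decompose-shift c (does-≡true⁻ (_ ≟ _) φv≡0))
                 (∈-map⁺ decompose u∈A)

    card-split : card S A ≡ size ℕ.* card S A∩ker
    card-split = begin
      card S A                                                  ≡⟨ length-map decompose (filterᵇ A vecs) ⟨
      length (List.map decompose (filterᵇ A vecs))             ≡⟨ length-unique decompose-unique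
                                                                     (Unique.cartesianProduct⁺ unique (filterᵇ-unique A∩ker))
                                                                     decompose-image ⟩
      length (cartesianProduct elements (filterᵇ A∩ker vecs))  ≡⟨ length-cartesianProductWith _,_ elements _ ⟩
      size ℕ.* card S A∩ker                                     ∎
      where
      open ≡-Reasoning
      decompose-unique : Unique (List.map decompose (filterᵇ A vecs))
      decompose-unique = Unique.map⁺ decompose-injective (filterᵇ-unique A)

  card-subspace : (A : Subset S) → IsSubspace S A → ∃ λ d → card S A ≡ size ^ d
  card-subspace A sA = go A sA (<-wellFounded (card S A))
    where
    go : (A : Subset S) → IsSubspace S A → Acc _<_ (card S A) → ∃ λ d → card S A ≡ size ^ d
    go A sA (acc smaller) with trivial-or-nonzero A
    ... | inj₁ trivial = 0 , card-trivial A (IsSubspace.zero-mem sA) trivial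
    ... | inj₂ (s , As , s≢0) with separating s s≢0
    ... | φ , φ-lin , φs≢0 =
      let open KernelSplit A sA As φ-lin φs≢0
          (d , card≡) = go A∩ker A∩ker-isSubspace (smaller card-A∩ker-<)
      in suc d , trans card-split (cong (size ℕ.*_) card≡)

  size^dim≡card : (A : Subset S) → IsSubspace S A → size ^ dim S A ≡ card S A
  size^dim≡card A sA with card-subspace A sA
  ... | d , card≡ = trans (cong (size ^_) dim≡d) (sym card≡)
    where
    dim≡d : dim S A ≡ d
    dim≡d = trans (cong (logBase size) card≡) (logBase-^ 1<size d)

  dim≡0⇒trivial : (A : Subset S) → IsSubspace S A → dim S A ≡ 0 → ∀ v → A v ≡ true → v ≡ 0v
  dim≡0⇒trivial A sA dim≡0 v Av = decidable-stable (v ≟v 0v) λ v≢0 →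
    ℕ.<-irrefl card-origin≡card-A (card-< origin A origin⊆A Av (dec-false (v ≟v 0v) v≢0))
    where
    origin : Subset S
    origin w = does (w ≟v 0v)
    origin⊆A : _⊆_ S origin A
    origin⊆A w w≡0 rewrite does-≡true⁻ (w ≟v 0v) w≡0 = IsSubspace.zero-mem sA
    card-origin≡card-A : card S origin ≡ card S A
    card-origin≡card-A = begin
      card S origin    ≡⟨ card-trivial origin (dec-true (0v ≟v 0v) refl) (λ w → does-≡true⁻ (w ≟v 0v)) ⟩
      1                ≡⟨ cong (size ^_) dim≡0 ⟨
      size ^ dim S A   ≡⟨ size^dim≡card A sA ⟩
      card S A         ∎
      where open ≡-Reasoning

  dim≢0⇒nonzero : (A : Subset S) → IsSubspace S A → dim S A ≢ 0 → ∃ λ v → A v ≡ true × v ≢ 0v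
  dim≢0⇒nonzero A sA dim≢0 with trivial-or-nonzero A
  ... | inj₁ trivial =
    contradiction (cong (logBase size) (card-trivial A (IsSubspace.zero-mem sA) trivial)) dim≢0
  ... | inj₂ nonzero = nonzero

  ⊆-dim-≡⇒⊇ : (A B : Subset S) → IsSubspace S A → IsSubspace S B → _⊆_ S A B → dim S A ≡ dim S B →
              _⊆_ S B A
  ⊆-dim-≡⇒⊇ A B sA sB A⊆B dim≡ v Bv with A v in Av
  ... | true  = refl
  ... | false = contradiction card≡ (ℕ.<⇒≢ (card-< A B A⊆B Bv Av))
    where
    card≡ : card S A ≡ card S B
    card≡ = trans (sym (size^dim≡card A sA)) (trans (cong (size ^_) dim≡) (size^dim≡card B sB))

-- Orthogonal complements, column spaces and supports

module _ {F : FiniteField} where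
  open FieldProperties F
  open ≡-Reasoning

  dot-linear : ∀ {n} (u : Vec Carrier n) → IsLinearFunctional (E F n) (dot F n u)
  dot-linear u = record { +-hom = +-hom u ; ·-hom = ·-hom u }
    where
    +-hom : ∀ {n} (u v w : Vec Carrier n) → dot F n u (Vec.zipWith _+_ v w) ≡ dot F n u v + dot F n u w
    +-hom Vec.[]       Vec.[]       Vec.[]       = sym (+-identityʳ 0#)
    +-hom (a Vec.∷ u) (b Vec.∷ v) (c Vec.∷ w) = begin
      a * (b + c) + dot F _ u (Vec.zipWith _+_ v w)    ≡⟨ cong₂ _+_ (distribˡ a b c) (+-hom u v w) ⟩
      (a * b + a * c) + (dot F _ u v + dot F _ u w)    ≡⟨ +-interchange _ _ _ _ ⟩
      (a * b + dot F _ u v) + (a * c + dot F _ u w)    ∎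
    ·-hom : ∀ {n} (u : Vec Carrier n) c v → dot F n u (Vec.map (c *_) v) ≡ c * dot F n u v
    ·-hom Vec.[]       c Vec.[]       = sym (zeroʳ c)
    ·-hom (a Vec.∷ u) c (b Vec.∷ v) = begin
      a * (c * b) + dot F _ u (Vec.map (c *_) v)  ≡⟨ cong₂ _+_ (*-leftCommute a c b) (·-hom u c v) ⟩
      c * (a * b) + c * dot F _ u v               ≡⟨ distribˡ c _ _ ⟨
      c * (a * b + dot F _ u v)                   ∎

  ⊥-isSubspace : ∀ {n} (U : Subset (E F n)) → IsSubspace (E F n) (_⊥ F n U)
  ⊥-isSubspace {n} U = record
    { zero-mem    = ⊥⁺ λ {u} _ → linear-0v (dot-linear u)
    ; add-closed  = λ v w v⊥U w⊥U → ⊥⁺ λ {u} Uu → begin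
        dot F n u (Vec.zipWith _+_ v w)   ≡⟨ +-hom (dot-linear u) v w ⟩
        dot F n u v + dot F n u w         ≡⟨ cong₂ _+_ (⊥⁻ v⊥U Uu) (⊥⁻ w⊥U Uu) ⟩
        0# + 0#                           ≡⟨ +-identityʳ 0# ⟩
        0#                                ∎
    ; scal-closed = λ c v v⊥U → ⊥⁺ λ {u} Uu → begin
        dot F n u (Vec.map (c *_) v)  ≡⟨ ·-hom (dot-linear u) c v ⟩
        c * dot F n u v               ≡⟨ cong (c *_) (⊥⁻ v⊥U Uu) ⟩
        c * 0#                        ≡⟨ zeroʳ c ⟩
        0#                            ∎ }
    where
    open SubspaceCounting (vecSpace-isFinVectorSpace {F} n) using (linear-0v)
    open IsFinVectorSpace (vecSpace-isFinVectorSpace {F} n) using (∈-vecs)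
    open IsLinearFunctional
    ⊥⁺ : ∀ {v} → (∀ {u} → U u ≡ true → dot F n u v ≡ 0#) → _⊥ F n U v ≡ true
    ⊥⁺ {v} h = all-≡true⁺ _ (FinSpace.vecs (E F n)) λ {u} _ → ∨-≡true⁺ (U u) λ Uu → dec-true (_ ≟ _) (h Uu)
    ⊥⁻ : ∀ {v u} → _⊥ F n U v ≡ true → U u ≡ true → dot F n u v ≡ 0#
    ⊥⁻ {v} {u} v⊥U Uu = does-≡true⁻ (_ ≟ _) (∨-≡true⁻ (U u) (all-≡true⁻ _ v⊥U (∈-vecs u)) Uu)

  dot-0ˡ : ∀ {n} (v : Vec Carrier n) → dot F n (Vec.replicate n 0#) v ≡ 0#
  dot-0ˡ Vec.[]       = refl
  dot-0ˡ (b Vec.∷ v) = trans (cong₂ _+_ (zeroˡ b) (dot-0ˡ v)) (+-identityʳ 0#)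

  orthogonal-to-all⇒0 : ∀ {n} (v : Vec Carrier n) → (∀ u → dot F n u v ≡ 0#) → v ≡ Vec.replicate n 0#
  orthogonal-to-all⇒0 Vec.[]                 _   = refl
  orthogonal-to-all⇒0 {suc n} (a Vec.∷ v) v⊥ = cong₂ Vec._∷_ a≡0 (orthogonal-to-all⇒0 v λ u → begin
      dot F n u v                             ≡⟨ +-identityˡ _ ⟨
      0# + dot F n u v                        ≡⟨ cong (_+ dot F n u v) (zeroˡ a) ⟨
      dot F (suc n) (0# Vec.∷ u) (a Vec.∷ v)  ≡⟨ v⊥ (0# Vec.∷ u) ⟩
      0#                                      ∎)
    where
    a≡0 : a ≡ 0#
    a≡0 = begin
      a                                                        ≡⟨ +-identityʳ a ⟨
      a + 0#                                                   ≡⟨ cong₂ _+_ (*-identityˡ a) (dot-0ˡ v) ⟨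
      dot F (suc n) (1# Vec.∷ Vec.replicate n 0#) (a Vec.∷ v)  ≡⟨ v⊥ (1# Vec.∷ Vec.replicate n 0#) ⟩
      0#                                                       ∎

  whole-isSubspace : ∀ {n} → IsSubspace (E F n) (whole F n)
  whole-isSubspace = record { zero-mem = refl ; add-closed = λ _ _ _ _ → refl ; scal-closed = λ _ _ _ → refl }

  whole⊥-trivial : ∀ {n} v → _⊥ F n (whole F n) v ≡ true → v ≡ Vec.replicate n 0#
  whole⊥-trivial {n} v v⊥ = orthogonal-to-all⇒0 v λ u →
    does-≡true⁻ (_ ≟ _) (all-≡true⁻ _ v⊥ (IsFinVectorSpace.∈-vecs (vecSpace-isFinVectorSpace {F} n) u))

  module _ {m : ℕ} where

    column-+ : ∀ {n} (M N : Mat F n m) j →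
               column (Vec.zipWith (Vec.zipWith _+_) M N) j ≡ Vec.zipWith _+_ (column M j) (column N j)
    column-+ Vec.[]       Vec.[]       j = refl
    column-+ (r Vec.∷ M) (s Vec.∷ N) j = cong₂ Vec._∷_ (Vec.lookup-zipWith _+_ j r s) (column-+ M N j)

    column-· : ∀ {n} c (M : Mat F n m) j → column (Vec.map (Vec.map (c *_)) M) j ≡ Vec.map (c *_) (column M j)
    column-· c Vec.[]       j = refl
    column-· c (r Vec.∷ M) j = cong₂ Vec._∷_ (Vec.lookup-map j (c *_) r) (column-· c M j)

    column-0 : ∀ n j → column (Vec.replicate n (Vec.replicate m 0#)) j ≡ Vec.replicate n 0#
    column-0 zero    j = refl
    column-0 (suc n) j = cong₂ Vec._∷_ (Vec.lookup-replicate j 0#) (column-0 n j)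

    columns-0⇒0 : ∀ {n} (M : Mat F n m) → (∀ j → column M j ≡ Vec.replicate n 0#) →
                  M ≡ Vec.replicate n (Vec.replicate m 0#)
    columns-0⇒0 Vec.[]       _       = refl
    columns-0⇒0 (r Vec.∷ M) cols≡0 =
      cong₂ Vec._∷_ (row≡0 r (λ j → cong Vec.head (cols≡0 j))) (columns-0⇒0 M (λ j → cong Vec.tail (cols≡0 j)))
      where
      row≡0 : ∀ {k} (r : Vec Carrier k) → (∀ j → Vec.lookup r j ≡ 0#) → r ≡ Vec.replicate k 0#
      row≡0 Vec.[]       _      = refl
      row≡0 (a Vec.∷ r) r[]≡0 = cong₂ Vec._∷_ (r[]≡0 Fin.zero) (row≡0 r (r[]≡0 ∘ Fin.suc))

    colsp⊆⁺ : ∀ {n} (M : Mat F n m) W → (∀ j → W (column M j) ≡ true) → colsp⊆ {F} M W ≡ true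
    colsp⊆⁺ M W cols∈W = all-≡true⁺ _ (List.allFin m) (λ {j} _ → cols∈W j)

    colsp⊆⁻ : ∀ {n} (M : Mat F n m) W → colsp⊆ {F} M W ≡ true → ∀ j → W (column M j) ≡ true
    colsp⊆⁻ M W M⊆W j = all-≡true⁻ _ M⊆W (∈-allFin j)

    restrict-isSubspace : ∀ {n} {C W} → IsSubspace (MatSpace F n m) C → IsSubspace (E F n) W →
                          IsSubspace (MatSpace F n m) (restrict {F} C W)
    restrict-isSubspace {n} {C} {W} sC sW = record
      { zero-mem    = ∧-≡true⁺ (C.zero-mem) (colsp⊆⁺ _ W λ j →
          subst (λ v → W v ≡ true) (sym (column-0 n j)) W.zero-mem)
      ; add-closed  = λ M N M∈ N∈ →
          let (CM , M⊆W) = ∧-≡true⁻ M∈ ; (CN , N⊆W) = ∧-≡true⁻ N∈ in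
          ∧-≡true⁺ (C.add-closed M N CM CN) (colsp⊆⁺ _ W λ j →
            subst (λ v → W v ≡ true) (sym (column-+ M N j))
              (W.add-closed _ _ (colsp⊆⁻ M W M⊆W j) (colsp⊆⁻ N W N⊆W j)))
      ; scal-closed = λ c M M∈ →
          let (CM , M⊆W) = ∧-≡true⁻ M∈ in
          ∧-≡true⁺ (C.scal-closed c M CM) (colsp⊆⁺ _ W λ j →
            subst (λ v → W v ≡ true) (sym (column-· c M j)) (W.scal-closed c _ (colsp⊆⁻ M W M⊆W j))) }
      where
      module C = IsSubspace sC
      module W = IsSubspace sW

  e₀ : ∀ m → Vec Carrier (suc m)
  e₀ m = 1# Vec.∷ Vec.replicate m 0#

  module _ {m} {ψ : Vec Carrier (suc m) → Carrier} (ψ-lin : IsLinearFunctional (VecSpace F (suc m)) ψ) where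
    open IsLinearFunctional ψ-lin

    tail-linear : IsLinearFunctional (VecSpace F m) (λ t → ψ (0# Vec.∷ t))
    tail-linear = record
      { +-hom = λ a b → trans (cong (λ z → ψ (z Vec.∷ Vec.zipWith _+_ a b)) (sym (+-identityʳ 0#)))
                              (+-hom (0# Vec.∷ a) (0# Vec.∷ b))
      ; ·-hom = λ c a → trans (cong (λ z → ψ (z Vec.∷ Vec.map (c *_) a)) (sym (zeroʳ c)))
                              (·-hom c (0# Vec.∷ a)) }

    head-tail : ∀ h t → ψ (h Vec.∷ t) ≡ ψ (e₀ m) * h + ψ (0# Vec.∷ t)
    head-tail h t = begin
      ψ (h Vec.∷ t)                                              ≡⟨ cong ψ h∷t≡he₀+0∷t ⟩
      ψ (Vec.zipWith _+_ (Vec.map (h *_) (e₀ m)) (0# Vec.∷ t))   ≡⟨ +-hom _ _ ⟩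
      ψ (Vec.map (h *_) (e₀ m)) + ψ (0# Vec.∷ t)                 ≡⟨ cong (_+ ψ (0# Vec.∷ t)) (·-hom h (e₀ m)) ⟩
      h * ψ (e₀ m) + ψ (0# Vec.∷ t)                              ≡⟨ cong (_+ ψ (0# Vec.∷ t)) (*-comm h (ψ (e₀ m))) ⟩
      ψ (e₀ m) * h + ψ (0# Vec.∷ t)                              ∎
      where
      h0≡0 : Vec.map (h *_) (Vec.replicate m 0#) ≡ Vec.replicate m 0#
      h0≡0 = trans (Vec.map-replicate (h *_) 0# m) (cong (Vec.replicate m) (zeroʳ h))
      h∷t≡he₀+0∷t : h Vec.∷ t ≡ Vec.zipWith _+_ (Vec.map (h *_) (e₀ m)) (0# Vec.∷ t)
      h∷t≡he₀+0∷t = sym (cong₂ Vec._∷_ (trans (+-identityʳ _) (*-identityʳ h)) (begin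
        Vec.zipWith _+_ (Vec.map (h *_) (Vec.replicate m 0#)) t  ≡⟨ cong (λ z → Vec.zipWith _+_ z t) h0≡0 ⟩
        Vec.zipWith _+_ (Vec.replicate m 0#) t                  ≡⟨ Vec.zipWith-identityˡ +-identityˡ t ⟩
        t                                                       ∎))

  column-tail : ∀ {n m} (R : Mat F n (suc m)) j → column (Vec.map Vec.tail R) j ≡ column R (Fin.suc j)
  column-tail Vec.[]                  j = refl
  column-tail ((h Vec.∷ t) Vec.∷ R) j = cong (Vec.lookup t j Vec.∷_) (column-tail R j)

  map-linear-∈ : ∀ {n m} {W} → IsSubspace (E F n) W → (R : Mat F n m) → (∀ j → W (column R j) ≡ true) →
                 ∀ {ψ} → IsLinearFunctional (VecSpace F m) ψ → W (Vec.map ψ R) ≡ true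
  map-linear-∈ {n} {zero} {W} sW R _ {ψ} ψ-lin =
    subst (λ v → W v ≡ true) (sym map-ψ≡0) (IsSubspace.zero-mem sW)
    where
    open SubspaceCounting (vecSpace-isFinVectorSpace {F} 0) using (linear-0v)
    map-ψ≡0 : ∀ {k} {R : Mat F k 0} → Vec.map ψ R ≡ Vec.replicate k 0#
    map-ψ≡0 {R = Vec.[]}          = refl
    map-ψ≡0 {R = Vec.[] Vec.∷ R} = cong₂ Vec._∷_ (linear-0v ψ-lin) map-ψ≡0
  map-linear-∈ {n} {suc m} {W} sW R cols∈W {ψ} ψ-lin =
    subst (λ v → W v ≡ true) (sym (decomposition R))
      (add-closed _ _ (scal-closed κ _ (cols∈W Fin.zero))
                      (map-linear-∈ sW (Vec.map Vec.tail R) tail-cols∈W (tail-linear ψ-lin)))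
    where
    open IsSubspace sW
    κ : Carrier
    κ = ψ (e₀ m)
    tail-cols∈W : ∀ j → W (column (Vec.map Vec.tail R) j) ≡ true
    tail-cols∈W j = subst (λ v → W v ≡ true) (sym (column-tail R j)) (cols∈W (Fin.suc j))
    decomposition : ∀ {k} (R : Mat F k (suc m)) → Vec.map ψ R ≡
      Vec.zipWith _+_ (Vec.map (κ *_) (column R Fin.zero))
                      (Vec.map (λ t → ψ (0# Vec.∷ t)) (Vec.map Vec.tail R))
    decomposition Vec.[]                  = refl
    decomposition ((h Vec.∷ t) Vec.∷ R) = cong₂ Vec._∷_ (head-tail ψ-lin h t) (decomposition R)

module ExtensionProperties {F : FiniteField} {m : ℕ} (X : Extension F m) where
  open Extension X
  private
    module F = FieldProperties F
    module L = FieldProperties L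
  open ≡-Reasoning

  coord⁻¹ : Vec F.Carrier m → L.Carrier
  coord⁻¹ v = proj₁ (coord-surj v)

  coord-coord⁻¹ : ∀ v → coord (coord⁻¹ v) ≡ v
  coord-coord⁻¹ v = proj₂ (coord-surj v)

  coord⁻¹-coord : ∀ x → coord⁻¹ (coord x) ≡ x
  coord⁻¹-coord x = coord-inj _ _ (coord-coord⁻¹ (coord x))

  coord⁻¹-+ : ∀ v w → coord⁻¹ (Vec.zipWith F._+_ v w) ≡ coord⁻¹ v L.+ coord⁻¹ w
  coord⁻¹-+ v w = coord-inj _ _ (begin
    coord (coord⁻¹ (Vec.zipWith F._+_ v w))                         ≡⟨ coord-coord⁻¹ _ ⟩
    Vec.zipWith F._+_ v w
      ≡⟨ cong₂ (Vec.zipWith F._+_) (coord-coord⁻¹ v) (coord-coord⁻¹ w) ⟨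
    Vec.zipWith F._+_ (coord (coord⁻¹ v)) (coord (coord⁻¹ w))      ≡⟨ coord-+ _ _ ⟨
    coord (coord⁻¹ v L.+ coord⁻¹ w)                                ∎)

  coord⁻¹-· : ∀ c v → coord⁻¹ (Vec.map (c F.*_) v) ≡ ι c L.* coord⁻¹ v
  coord⁻¹-· c v = coord-inj _ _ (begin
    coord (coord⁻¹ (Vec.map (c F.*_) v))     ≡⟨ coord-coord⁻¹ _ ⟩
    Vec.map (c F.*_) v                       ≡⟨ cong (Vec.map (c F.*_)) (coord-coord⁻¹ v) ⟨
    Vec.map (c F.*_) (coord (coord⁻¹ v))     ≡⟨ coord-· c _ ⟨
    coord (ι c L.* coord⁻¹ v)                ∎)

  coord-0 : coord L.0# ≡ Vec.replicate m F.0#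
  coord-0 = begin
    coord L.0#                                ≡⟨ cong coord (L.zeroʳ (ι F.0#)) ⟨
    coord (ι F.0# L.* L.0#)                   ≡⟨ coord-· F.0# L.0# ⟩
    Vec.map (F.0# F.*_) (coord L.0#)          ≡⟨ F.map-0* (coord L.0#) ⟩
    Vec.replicate m F.0#                      ∎

  expand-0 : ∀ {n} → expand X (Vec.replicate n L.0#) ≡ Vec.replicate n (Vec.replicate m F.0#)
  expand-0 {n} = trans (Vec.map-replicate coord L.0# n) (cong (Vec.replicate n) coord-0)

  expand-coord⁻¹ : ∀ {n} (M : Mat F n m) → expand X (Vec.map coord⁻¹ M) ≡ M
  expand-coord⁻¹ M =
    trans (sym (Vec.map-∘ coord coord⁻¹ M)) (trans (Vec.map-cong coord-coord⁻¹ M) (Vec.map-id M))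

  scaled-coordinate : L.Carrier → Fin m → Vec F.Carrier m → F.Carrier
  scaled-coordinate μ j v = Vec.lookup (coord (μ L.* coord⁻¹ v)) j

  scaled-coordinate-linear : ∀ μ j → IsLinearFunctional (VecSpace F m) (scaled-coordinate μ j)
  scaled-coordinate-linear μ j = record
    { +-hom = λ v w → begin
        Vec.lookup (coord (μ L.* coord⁻¹ (Vec.zipWith F._+_ v w))) j
          ≡⟨ cong (λ z → Vec.lookup (coord (μ L.* z)) j) (coord⁻¹-+ v w) ⟩
        Vec.lookup (coord (μ L.* (coord⁻¹ v L.+ coord⁻¹ w))) j
          ≡⟨ cong (λ z → Vec.lookup (coord z) j) (L.distribˡ μ _ _) ⟩
        Vec.lookup (coord (μ L.* coord⁻¹ v L.+ μ L.* coord⁻¹ w)) j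
          ≡⟨ cong (λ z → Vec.lookup z j) (coord-+ _ _) ⟩
        Vec.lookup (Vec.zipWith F._+_ (coord (μ L.* coord⁻¹ v)) (coord (μ L.* coord⁻¹ w))) j
          ≡⟨ Vec.lookup-zipWith F._+_ j (coord (μ L.* coord⁻¹ v)) (coord (μ L.* coord⁻¹ w)) ⟩
        scaled-coordinate μ j v F.+ scaled-coordinate μ j w
          ∎
    ; ·-hom = λ c v → begin
        Vec.lookup (coord (μ L.* coord⁻¹ (Vec.map (c F.*_) v))) j
          ≡⟨ cong (λ z → Vec.lookup (coord (μ L.* z)) j) (coord⁻¹-· c v) ⟩
        Vec.lookup (coord (μ L.* (ι c L.* coord⁻¹ v))) j
          ≡⟨ cong (λ z → Vec.lookup (coord z) j) (L.*-leftCommute μ (ι c) _) ⟩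
        Vec.lookup (coord (ι c L.* (μ L.* coord⁻¹ v))) j
          ≡⟨ cong (λ z → Vec.lookup z j) (coord-· c _) ⟩
        Vec.lookup (Vec.map (c F.*_) (coord (μ L.* coord⁻¹ v))) j
          ≡⟨ Vec.lookup-map j (c F.*_) (coord (μ L.* coord⁻¹ v)) ⟩
        c F.* scaled-coordinate μ j v
          ∎ }

  column-expand-scale : ∀ {n} μ (x : Vec L.Carrier n) j →
    column (expand X (Vec.map (μ L.*_) x)) j ≡ Vec.map (scaled-coordinate μ j) (expand X x)
  column-expand-scale μ Vec.[]       j = refl
  column-expand-scale μ (y Vec.∷ x) j =
    cong₂ Vec._∷_ (cong (λ z → Vec.lookup (coord (μ L.* z)) j) (sym (coord⁻¹-coord y)))
                  (column-expand-scale μ x j)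

  supp⊆-scale : ∀ {n} {W} → IsSubspace (E F n) W → ∀ μ (x : Vec L.Carrier n) →
                supp⊆ X x W ≡ true → supp⊆ X (Vec.map (μ L.*_) x) W ≡ true
  supp⊆-scale {W = W} sW μ x x⊆W = colsp⊆⁺ {F} (expand X (Vec.map (μ L.*_) x)) W λ j →
    subst (λ v → W v ≡ true) (sym (column-expand-scale μ x j))
      (map-linear-∈ sW (expand X x) (colsp⊆⁻ {F} (expand X x) W x⊆W) (scaled-coordinate-linear μ j))

-- Rank-one q-matroids

0≤i≤1⇒i≡0⊎i≡1 : ∀ {i} → + 0 ℤ.≤ i → i ℤ.≤ + 1 → i ≡ + 0 ⊎ i ≡ + 1
0≤i≤1⇒i≡0⊎i≡1 {+ 0}           _ _                     = inj₁ refl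
0≤i≤1⇒i≡0⊎i≡1 {+ 1}           _ _                     = inj₂ refl
0≤i≤1⇒i≡0⊎i≡1 {+ suc (suc _)} _ (ℤ.+≤+ (s≤s ()))

+m-+n≡0⇒m≡n : ∀ a b → + a ℤ.- + b ≡ + 0 → a ≡ b
+m-+n≡0⇒m≡n a b eq = ℤ.+-injective (ℤ.i-j≡0⇒i≡j (+ a) (+ b) eq)

+m-+n≡+m⇒n≡0 : ∀ a b → + a ℤ.- + b ≡ + a → b ≡ 0
+m-+n≡+m⇒n≡0 a b eq = ℤ.+-injective (ℤ.neg-injective (identityʳ-unique (+ a) (ℤ.- + b) eq))
  where open GroupProperties (AbelianGroup.group ℤ.+-0-abelianGroup) using (identityʳ-unique)

module LineCode {F : FiniteField} {m : ℕ} (X : Extension F m) {n : ℕ}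
                (x : Vec (FiniteField.Carrier (Extension.L X)) n)
                (x≢0 : x ≢ Vec.replicate n (FiniteField.0# (Extension.L X))) where
  open Extension X using (L)
  open ExtensionProperties X using (supp⊆-scale; expand-0)
  private
    module L = FieldProperties L
    VL = VecSpace L n
  open FinSpace VL using (_≟v_)
  open SubspaceCounting (vecSpace-isFinVectorSpace {L} n)

  line : L.Carrier → Vec L.Carrier n
  line μ = Vec.map (μ L.*_) x

  line-injective : ∀ {μ ν} → line μ ≡ line ν → μ ≡ ν
  line-injective {μ} {ν} line≡ with nonzero-entry L._≟_ x x≢0
  ... | i , xᵢ≢0 = L.*-cancelʳ-≢0 xᵢ≢0 (begin
    μ L.* Vec.lookup x i           ≡⟨ Vec.lookup-map i (μ L.*_) x ⟨
    Vec.lookup (line μ) i          ≡⟨ cong (λ y → Vec.lookup y i) line≡ ⟩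
    Vec.lookup (line ν) i          ≡⟨ Vec.lookup-map i (ν L.*_) x ⟩
    ν L.* Vec.lookup x i           ∎)
    where open ≡-Reasoning

  Line : Subset VL
  Line y = any (λ μ → does (y ≟v line μ)) L.elements

  Line⇔∈lines : ∀ {y} → Line y ≡ true ⇔ y ∈ List.map line L.elements
  Line⇔∈lines {y} = mk⇔
    (λ y∈Line → let (μ , _ , y≡) = any-≡true⁻ (λ μ → does (y ≟v line μ)) L.elements y∈Line in
      subst (_∈ List.map line L.elements) (sym (does-≡true⁻ (y ≟v line μ) y≡)) (∈-map⁺ line (L.complete μ)))
    (λ y∈lines → let (μ , _ , y≡) = ∈-map⁻ line y∈lines in
      any-≡true⁺ (λ μ → does (y ≟v line μ)) (L.complete μ) (dec-true (y ≟v line μ) y≡))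

  line∈Line : ∀ μ → Line (line μ) ≡ true
  line∈Line μ = Equivalence.from Line⇔∈lines (∈-map⁺ line (L.complete μ))

  Line⇒line : ∀ y → Line y ≡ true → ∃ λ μ → y ≡ line μ
  Line⇒line y y∈Line = let (μ , _ , y≡) = ∈-map⁻ line (Equivalence.to (Line⇔∈lines {y}) y∈Line) in μ , y≡

  line-0 : line L.0# ≡ Vec.replicate n L.0#
  line-0 = L.map-0* x

  Line-isSubspace : IsSubspace VL Line
  Line-isSubspace = record
    { zero-mem    = subst (λ y → Line y ≡ true) line-0 (line∈Line L.0#)
    ; add-closed  = λ y z y∈ z∈ → let (μ , y≡) = Line⇒line y y∈ ; (ν , z≡) = Line⇒line z z∈ in
        subst (λ w → Line w ≡ true) (sym (trans (cong₂ (Vec.zipWith L._+_) y≡ z≡) (L.map-*-+ μ ν x)))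
              (line∈Line (μ L.+ ν))
    ; scal-closed = λ c y y∈ → let (μ , y≡) = Line⇒line y y∈ in
        subst (λ w → Line w ≡ true) (sym (trans (cong (Vec.map (c L.*_)) y≡) (L.map-*-map-* c μ x)))
              (line∈Line (c L.* μ)) }

  dim-lines : (A : Subset VL) → (∀ {y} → A y ≡ true ⇔ y ∈ List.map line L.elements) → dim VL A ≡ 1
  dim-lines A A⇔lines = begin
    logBase L.size (card VL A)                        ≡⟨ cong (logBase L.size) card≡ ⟩
    logBase L.size (length (List.map line L.elements))  ≡⟨ cong (logBase L.size) (length-map line L.elements) ⟩
    logBase L.size L.size                             ≡⟨ cong (logBase L.size) (ℕ.*-identityʳ L.size) ⟨
    logBase L.size (L.size ^ 1)                       ≡⟨ logBase-^ L.1<size 1 ⟩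
    1                                                 ∎
    where
    open ≡-Reasoning
    card≡ : card VL A ≡ length (List.map line L.elements)
    card≡ = card-≡-length A (Unique.map⁺ line-injective L.unique) A⇔lines

  dim-Line : dim VL Line ≡ 1
  dim-Line = dim-lines Line Line⇔∈lines

  module _ {W : Subset (E F n)} (sW : IsSubspace (E F n) W) where

    dim-Line∩supp⊆ : supp⊆ X x W ≡ true → dim VL (λ y → Line y ∧ supp⊆ X y W) ≡ 1
    dim-Line∩supp⊆ x⊆W = dim-lines (λ y → Line y ∧ supp⊆ X y W) λ {y} → mk⇔
      (Equivalence.to (Line⇔∈lines {y}) ∘ proj₁ ∘ ∧-≡true⁻)
      (λ y∈lines → ∧-≡true⁺ (Equivalence.from Line⇔∈lines y∈lines) (supp-y⊆W y∈lines))
      where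
      supp-y⊆W : ∀ {y} → y ∈ List.map line L.elements → supp⊆ X y W ≡ true
      supp-y⊆W y∈lines = let (μ , _ , y≡) = ∈-map⁻ line y∈lines in
        subst (λ z → supp⊆ X z W ≡ true) (sym y≡) (supp⊆-scale sW μ x x⊆W)

    dim-Line∩supp⊈ : supp⊆ X x W ≡ false → dim VL (λ y → Line y ∧ supp⊆ X y W) ≡ 0
    dim-Line∩supp⊈ x⊈W = cong (logBase L.size) (card-trivial (λ y → Line y ∧ supp⊆ X y W) 0∈ only-0)
      where
      0∈ : Line (Vec.replicate n L.0#) ∧ supp⊆ X (Vec.replicate n L.0#) W ≡ true
      0∈ = ∧-≡true⁺ (IsSubspace.zero-mem Line-isSubspace) (colsp⊆⁺ {F} _ W λ j →
        subst (λ v → W v ≡ true) (sym (trans (cong (λ M → column M j) (expand-0 {n})) (column-0 {F} n j)))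
          (IsSubspace.zero-mem sW))
      only-0 : ∀ y → Line y ∧ supp⊆ X y W ≡ true → y ≡ Vec.replicate n L.0#
      only-0 y y∈ with ∧-≡true⁻ y∈
      ... | y∈Line , y⊆W with Line⇒line y y∈Line
      ... | μ , y≡ with μ L.≟ L.0#
      ... | yes refl = trans y≡ line-0
      ... | no  μ≢0 = contradiction (trans (sym x⊆W) x⊈W) λ ()
        where
        μ⁻¹ : L.Carrier
        μ⁻¹ = proj₁ (L.inverse μ μ≢0)
        μ⁻¹-line : Vec.map (μ⁻¹ L.*_) (line μ) ≡ x
        μ⁻¹-line = trans (L.map-*-map-* μ⁻¹ μ x)
          (trans (cong (λ c → Vec.map (c L.*_) x) (trans (L.*-comm μ⁻¹ μ) (proj₂ (L.inverse μ μ≢0))))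
                 (L.map-1* x))
        x⊆W : supp⊆ X x W ≡ true
        x⊆W = subst (λ z → supp⊆ X z W ≡ true) μ⁻¹-line
          (supp⊆-scale sW μ⁻¹ (line μ) (subst (λ z → supp⊆ X z W ≡ true) y≡ y⊆W))


module RankOne {F : FiniteField} {n : ℕ} (M : QMatroid F n) (rank≡1 : QMatroid.rank M ≡ + 1)
               {m : ℕ} (m≢0 : m ≢ 0) (X : Extension F m) (matrixRep : MatrixRepresentable M m) where
  open QMatroid M
  open FiniteField F using (size; 0#)
  open ExtensionProperties X using (coord⁻¹; expand-coord⁻¹; expand-0)
  open SubspaceCounting (matSpace-isFinVectorSpace {F} n m)
  private
    MS = MatSpace F n m
    C = proj₁ matrixRep
    sC = proj₁ (proj₂ matrixRep)
    rep = proj₂ (proj₂ matrixRep)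

  C⊆ : Subset (E F n) → Subset MS
  C⊆ = restrict {F} C

  C⊆⊥-isSubspace : ∀ {W} → IsSubspace MS (C⊆ (_⊥ F n W))
  C⊆⊥-isSubspace {W} = restrict-isSubspace sC (⊥-isSubspace W)

  dim-C⊆whole⊥ : dim MS (C⊆ (_⊥ F n (whole F n))) ≡ 0
  dim-C⊆whole⊥ = cong (logBase size) (card-trivial _ (IsSubspace.zero-mem C⊆⊥-isSubspace) only-0)
    where
    only-0 : ∀ N → C⊆ (_⊥ F n (whole F n)) N ≡ true → N ≡ Vec.replicate n (Vec.replicate m 0#)
    only-0 N N∈ = columns-0⇒0 {F} N λ j →
      whole⊥-trivial {F} _ (colsp⊆⁻ {F} N (_⊥ F n (whole F n)) (proj₂ (∧-≡true⁻ N∈)) j)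

  dim-C : dim MS C ≡ m
  dim-C = sym (ℤ.+-injective (begin
    + m                                                    ≡⟨ ℤ.*-identityʳ (+ m) ⟨
    + m ℤ.* + 1                                            ≡⟨ cong (+ m ℤ.*_) rank≡1 ⟨
    + m ℤ.* rank                                           ≡⟨ rep (whole F n) whole-isSubspace ⟩
    + dim MS C ℤ.- + dim MS (C⊆ (_⊥ F n (whole F n)))      ≡⟨ cong (λ d → + dim MS C ℤ.- + d) dim-C⊆whole⊥ ⟩
    + dim MS C ℤ.- + 0                                     ≡⟨ ℤ.+-identityʳ (+ dim MS C) ⟩
    + dim MS C                                             ∎))
    where open ≡-Reasoning

  rank-0-or-1 : ∀ W → IsSubspace (E F n) W → ρ W ≡ + 0 ⊎ ρ W ≡ + 1
  rank-0-or-1 W sW = 0≤i≤1⇒i≡0⊎i≡1 (proj₁ (R1 W sW))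
    (subst (ρ W ℤ.≤_) rank≡1 (R2 W (whole F n) sW whole-isSubspace (λ _ _ → refl)))

  m*ρ≡m-dim-C⊆⊥ : ∀ W → IsSubspace (E F n) W → + m ℤ.* ρ W ≡ + m ℤ.- + dim MS (C⊆ (_⊥ F n W))
  m*ρ≡m-dim-C⊆⊥ W sW = trans (rep W sW) (cong (λ d → + d ℤ.- + dim MS (C⊆ (_⊥ F n W))) dim-C)

  private
    nonzero-codeword : ∃ λ M₀ → C M₀ ≡ true × M₀ ≢ Vec.replicate n (Vec.replicate m 0#)
    nonzero-codeword = dim≢0⇒nonzero C sC (m≢0 ∘ trans (sym dim-C))

  M₀ : Mat F n m
  M₀ = proj₁ nonzero-codeword

  M₀∈C : C M₀ ≡ true
  M₀∈C = proj₁ (proj₂ nonzero-codeword)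

  M₀≢0 : M₀ ≢ Vec.replicate n (Vec.replicate m 0#)
  M₀≢0 = proj₂ (proj₂ nonzero-codeword)

  x₀ : Vec (FiniteField.Carrier (Extension.L X)) n
  x₀ = Vec.map coord⁻¹ M₀

  x₀≢0 : x₀ ≢ Vec.replicate n (FiniteField.0# (Extension.L X))
  x₀≢0 x₀≡0 = M₀≢0 (trans (sym (expand-coord⁻¹ M₀)) (trans (cong (expand X) x₀≡0) expand-0))

  rank-0⇒supp⊆ : ∀ W → IsSubspace (E F n) W → ρ W ≡ + 0 → supp⊆ X x₀ (_⊥ F n W) ≡ true
  rank-0⇒supp⊆ W sW ρ≡0 = subst (λ N → colsp⊆ {F} N (_⊥ F n W) ≡ true) (sym (expand-coord⁻¹ M₀))
    (proj₂ (∧-≡true⁻ (⊆-dim-≡⇒⊇ _ C C⊆⊥-isSubspace sC (λ _ → proj₁ ∘ ∧-≡true⁻) dim≡ M₀ M₀∈C)))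
    where
    dim≡ : dim MS (C⊆ (_⊥ F n W)) ≡ dim MS C
    dim≡ = trans (sym (+m-+n≡0⇒m≡n m _ (trans (sym (m*ρ≡m-dim-C⊆⊥ W sW))
                   (trans (cong (+ m ℤ.*_) ρ≡0) (ℤ.*-zeroʳ (+ m)))))) (sym dim-C)

  rank-1⇒supp⊈ : ∀ W → IsSubspace (E F n) W → ρ W ≡ + 1 → supp⊆ X x₀ (_⊥ F n W) ≡ false
  rank-1⇒supp⊈ W sW ρ≡1 with supp⊆ X x₀ (_⊥ F n W) in x₀⊆W⊥
  ... | false = refl
  ... | true  = contradiction (dim≡0⇒trivial _ C⊆⊥-isSubspace dim≡0 M₀ M₀∈C⊆W⊥) M₀≢0
    where
    dim≡0 : dim MS (C⊆ (_⊥ F n W)) ≡ 0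
    dim≡0 = +m-+n≡+m⇒n≡0 m _ (trans (sym (m*ρ≡m-dim-C⊆⊥ W sW))
              (trans (cong (+ m ℤ.*_) ρ≡1) (ℤ.*-identityʳ (+ m))))
    M₀∈C⊆W⊥ : C⊆ (_⊥ F n W) M₀ ≡ true
    M₀∈C⊆W⊥ = ∧-≡true⁺ M₀∈C (subst (λ N → colsp⊆ {F} N (_⊥ F n W) ≡ true) (expand-coord⁻¹ M₀) x₀⊆W⊥)

  open LineCode X x₀ x₀≢0

  private
    VL = VecSpace (Extension.L X) n

  -- The case split is an argument rather than a `with`: abstracting over it would make Agda
  -- normalise the dimensions in the goal, which unfolds `logBase` over all of F_{q^m}^n.
  rank-formula : ∀ W → IsSubspace (E F n) W → ρ W ≡ + 0 ⊎ ρ W ≡ + 1 →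
                 ρ W ≡ + dim VL Line ℤ.- + dim VL (λ y → Line y ∧ supp⊆ X y (_⊥ F n W))
  rank-formula W sW (inj₁ ρ≡0) = begin
    ρ W          ≡⟨ ρ≡0 ⟩
    + 1 ℤ.- + 1  ≡⟨ cong₂ (λ a b → + a ℤ.- + b) dim-Line
                          (dim-Line∩supp⊆ (⊥-isSubspace W) (rank-0⇒supp⊆ W sW ρ≡0)) ⟨
    + dim VL Line ℤ.- + dim VL (λ y → Line y ∧ supp⊆ X y (_⊥ F n W))  ∎
    where open ≡-Reasoning
  rank-formula W sW (inj₂ ρ≡1) = begin
    ρ W          ≡⟨ ρ≡1 ⟩
    + 1 ℤ.- + 0  ≡⟨ cong₂ (λ a b → + a ℤ.- + b) dim-Line
                          (dim-Line∩supp⊈ (⊥-isSubspace W) (rank-1⇒supp⊈ W sW ρ≡1)) ⟨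
    + dim VL Line ℤ.- + dim VL (λ y → Line y ∧ supp⊆ X y (_⊥ F n W))  ∎
    where open ≡-Reasoning

  extRepresentable : ExtRepresentable X M
  extRepresentable = Line , Line-isSubspace , λ W sW → rank-formula W sW (rank-0-or-1 W sW)

theorem6p9 : (F : FiniteField) (n : ℕ) → 2 ≤ n →
    (M : QMatroid F n) → QMatroid.rank M ≡ + 1 →
    (m : ℕ) → 1 < m → (X : Extension F m) →
    ¬ PurelyMultilinear X M
theorem6p9 F n _ M rank≡1 m 1<m X (matrixRep , ¬extRep) =
  ¬extRep (RankOne.extRepresentable M rank≡1 (ℕ.m<n⇒n≢0 1<m) X matrixRep)
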